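{- Fix integers $d\ge 0$, $m\ge 1$, $r\ge 0$ and let $a,b\in\mathbb{N}^{d+2}$. (1) For every $k\in\{0,\dots,d\}$, if $t_k(a,b)\in\mathbb{N}^{d+2}$ and $v_k(b)\in\mathbb{N}^{d+2}$ then $0\le\mathrm{measure}_{(d)}(t_k(a,b),v_k(b))<\mathrm{measure}_{(d)}(a,b)$. (2) For every $k\in\{0,\dots,d+1\}$, if $u_k(a)\in\mathbb{N}^{d+2}$ then $0\le\mathrm{measure}_{(d)}(u_k(a),b)<\mathrm{measure}_{(d)}(a,b)$.
   Context: Vectors are indexed $a=(a_0,\dots,a_{d+1})$; $a\le b$ means componentwise. Define $t_k(a,b)=(a_0,\dots,a_{k-1},a_k-1,a_{k+1}+r(b_{k+1}+m),\dots,a_{d+1}+r(b_{d+1}+m))$, $u_k(a)=(a_0,\dots,a_{k-1},a_k-1,a_{k+1},\dots,a_{d+1})$, $v_k(b)=(b_0,\dots,b_k,b_{k+1}+m,\dots,b_{d+1}+m)$. $\mathrm{measure}_{(i)}:\mathbb{Z}^{i+2}\times\mathbb{Z}^{i+2}\to\mathbb{Z}$ is defined by $\mathrm{measure}_{(-1)}(a_0,b_0)=a_0$ and $\mathrm{measure}_{(i+1)}((a_0,\dots,a_{i+2}),(b_0,\dots,b_{i+2}))=\mathrm{measure}_{(i)}\big((a_1+(r+1)(b_1+a_0m)a_0,\dots,a_{i+2}+(r+1)(b_{i+2}+a_0m)a_0),\ (b_1+a_0m,\dots,b_{i+2}+a_0m)\big)$. (In the paper $m$ is the size of a fixed program, $r$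 its maximal number of occurrences of a variable and $d$ the depth of its typing derivation.) -}

module Defs where

open import Data.Nat using (ℕ; zero; suc)
open import Data.Integer using (ℤ; +_; _+_; _-_; _*_; 1ℤ; 0ℤ; _≤_)
open import Data.Fin using (Fin; toℕ)
open import Data.Vec using (Vec; []; _∷_; tabulate; lookup; zipWith; map)
open import Data.Vec.Relation.Unary.All using (All)

pick : {A : Set} → ℕ → ℕ → A → A → A → A
pick zero    zero    lt eq gt = eq
pick zero    (suc k) lt eq gt = lt
pick (suc j) zero    lt eq gt = gt
pick (suc j) (suc k) lt eq gt = pick j k lt eq gt

-- Componentwise nonnegativity: membership in ℕ^{n}.
Nat-vec : {n : ℕ} → Vec ℤ n → Set
Nat-vec = All (0ℤ ≤_)

t : (m r : ℕ) {d : ℕ} → ℕ → Vec ℤ (suc (suc d)) → Vec ℤ (suc (suc d)) → Vec ℤ (suc (suc d))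
t m r k a b = tabulate λ j →
  pick (toℕ j) k (lookup a j) (lookup a j - 1ℤ) (lookup a j + (+ r) * (lookup b j + (+ m)))

u : {d : ℕ} → ℕ → Vec ℤ (suc (suc d)) → Vec ℤ (suc (suc d))
u k a = tabulate λ j → pick (toℕ j) k (lookup a j) (lookup a j - 1ℤ) (lookup a j)

v : (m : ℕ) {d : ℕ} → ℕ → Vec ℤ (suc (suc d)) → Vec ℤ (suc (suc d))
v m k b = tabulate λ j → pick (toℕ j) k (lookup b j) (lookup b j) (lookup b j + (+ m))

-- measure' n  =  paper's measure_(n-1), on vectors of length n+1.
measure' : (m r : ℕ) (n : ℕ) → Vec ℤ (suc n) → Vec ℤ (suc n) → ℤ
measure' m r zero    (a₀ ∷ []) (b₀ ∷ []) = a₀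
measure' m r (suc n) (a₀ ∷ as) (b₀ ∷ bs) =
  measure' m r n
    (zipWith (λ x y → x + (+ r + 1ℤ) * (y + a₀ * (+ m)) * a₀) as bs)
    (map (λ y → y + a₀ * (+ m)) bs)

measure : (m r : ℕ) (d : ℕ) → Vec ℤ (suc (suc d)) → Vec ℤ (suc (suc d)) → ℤ
measure m r d = measure' m r (suc d)

module Submission where

-- Both parts of the lemma are instances of one monotonicity principle for
-- measure'.  One recursion step of measure' with leading entry c replaces
-- every later b-entry y by  b-step c y = y + c·m  and every later a-entry x
-- by  a-step c x y = x + (r+1)(y + c·m)c,  and both maps are monotone in all
-- arguments on nonnegative integers (strictly in x, and in c once m ≥ 1).
-- Hence measure' strictly decreases when a moves to a vector a′ ≺ a (below
-- entrywise, strictly somewhere) while b does not increase (measure-strict).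
--   (2) u_k(a) ≺ a, so part (2) is a direct instance (u-≺).
--   (1) t_k(a,b) is not below a, so we follow the recursion: before the
--   pivot k the two configurations agree and stay "shifted" (shifted-step);
--   beyond the pivot the extra r(b_j+m) is dominated by what the unit drop
--   of the pivot entry costs, so after the pivot step the a-vectors are
--   strictly below entrywise (carried-drop) and measure-strict applies.

open import Defs
open import Data.Nat using (ℕ; zero; suc; z≤n)
import Data.Nat as ℕ
import Data.Nat.Properties as ℕ
open import Data.Integer using (ℤ; 0ℤ; 1ℤ; -1ℤ; +_; _+_; _-_; _*_; _≤_; _<_; +≤+)
open import Data.Integer.Properties
open import Data.Integer.Tactic.RingSolver using (solve-∀)
open import Data.Fin using (Fin; toℕ) renaming (zero to fzero; suc to fsuc)
open import Data.Vec using (Vec; []; _∷_; tabulate; lookup; zipWith; map)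
open import Data.Vec.Properties using (tabulate∘lookup)
open import Data.Vec.Relation.Unary.All using ([]; _∷_)
open import Data.Vec.Relation.Binary.Pointwise.Inductive as Pointwise using (Pointwise; []; _∷_)
open import Data.Product using (_×_; _,_)
open import Relation.Binary.PropositionalEquality using (_≡_; refl; sym; subst)

i<i+j : ∀ {i j} → 1ℤ ≤ j → i < i + j
i<i+j {i} {j} 1≤j = suc[i]≤j⇒i<j (subst (_≤ i + j) (+-comm i 1ℤ) (+-monoʳ-≤ i 1≤j))

i-1<i : ∀ i → i - 1ℤ < i
i-1<i i = i≤pred[j]⇒i<j (≤-reflexive (+-comm i -1ℤ))

*-mono-≤-nonNeg : ∀ {i i′ j j′} → 0ℤ ≤ i → i ≤ i′ → 0ℤ ≤ j → j ≤ j′ → i * j ≤ i′ * j′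
*-mono-≤-nonNeg {i} {i′} {j} (+≤+ _) i≤i′ (+≤+ _) j≤j′ with ≤-trans (+≤+ z≤n) i≤i′
... | +≤+ _ = ≤-trans (*-monoʳ-≤-nonNeg j i≤i′) (*-monoˡ-≤-nonNeg i′ j≤j′)

*-nonNeg : ∀ {i j} → 0ℤ ≤ i → 0ℤ ≤ j → 0ℤ ≤ i * j
*-nonNeg 0≤i 0≤j = *-mono-≤-nonNeg ≤-refl 0≤i ≤-refl 0≤j

growth-suc-identity : ∀ (R M c y : ℤ) →
  (R + 1ℤ) * (y + (1ℤ + c) * M) * (1ℤ + c) ≡ (R + 1ℤ) * (y + c * M) * c + (R + 1ℤ) * ((y + c * M) + (1ℤ + c) * M)
growth-suc-identity = solve-∀

carry-identity : ∀ (R M c x y : ℤ) →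
  (x + (R + 1ℤ) * y + R * M) + (R + 1ℤ) * ((y + M) + c * M) * c
    ≡ (x + (R + 1ℤ) * (y + c * M) * c) + (R + 1ℤ) * (y + c * M) + R * M
carry-identity = solve-∀

drop-identity : ∀ (R M c x y : ℤ) →
  ((x + (R + 1ℤ) * y + R * M) + (R + 1ℤ) * ((y + M) + c * M) * c) + (M + (R + 1ℤ) * c * M)
    ≡ x + (R + 1ℤ) * (y + (c + 1ℤ) * M) * (c + 1ℤ)
drop-identity = solve-∀

b-carry-identity : ∀ (M c y : ℤ) → (y + M) + c * M ≡ (y + c * M) + M
b-carry-identity = solve-∀

b-drop-identity : ∀ (M c y : ℤ) → (y + M) + c * M ≡ y + (c + 1ℤ) * M
b-drop-identity = solve-∀

a-unit-identity : ∀ (g x : ℤ) → (x + 1ℤ) + g ≡ (x + g) + 1ℤ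
a-unit-identity = solve-∀

t-tail-identity : ∀ (R M x y : ℤ) → x + (R + 1ℤ) * y + R * M ≡ (x + R * (y + M)) + y
t-tail-identity = solve-∀

unit-identity : ∀ (x : ℤ) → x ≡ (x - 1ℤ) + 1ℤ
unit-identity = solve-∀

data _≺_ : ∀ {n} → Vec ℤ n → Vec ℤ n → Set where
  here  : ∀ {n x y} {xs ys : Vec ℤ n} → x < y → Pointwise _≤_ xs ys → (x ∷ xs) ≺ (y ∷ ys)
  there : ∀ {n x y} {xs ys : Vec ℤ n} → x ≤ y → xs ≺ ys → (x ∷ xs) ≺ (y ∷ ys)

≺-head : ∀ {n x y} {xs ys : Vec ℤ n} → (x ∷ xs) ≺ (y ∷ ys) → x ≤ y
≺-head (here x<y _) = <⇒≤ x<y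
≺-head (there x≤y _) = x≤y

pointwise-<⇒≺ : ∀ {n} {xs ys : Vec ℤ (suc n)} → Pointwise _<_ xs ys → xs ≺ ys
pointwise-<⇒≺ (x<y ∷ xs<ys) = here x<y (Pointwise.map <⇒≤ xs<ys)

u′ : ∀ {n} → ℕ → Vec ℤ n → Vec ℤ n
u′ k a = tabulate λ j → pick (toℕ j) k (lookup a j) (lookup a j - 1ℤ) (lookup a j)

u-≺ : ∀ {n} (k : Fin n) (a : Vec ℤ n) → u′ (toℕ k) a ≺ a
u-≺ fzero (x ∷ xs) =
  here (i-1<i x) (subst (λ zs → Pointwise _≤_ zs xs) (sym (tabulate∘lookup xs)) (Pointwise.refl ≤-refl))
u-≺ (fsuc k) (x ∷ xs) = there ≤-refl (u-≺ k xs)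

module _ (m r : ℕ) where

  -- One step of measure' with leading entry c maps a later pair (x, y) of
  -- entries to (a-step c x y , b-step c y).
  b-step : ℤ → ℤ → ℤ
  b-step c y = y + c * + m

  growth : ℤ → ℤ → ℤ
  growth c y = (+ r + 1ℤ) * b-step c y * c

  a-step : ℤ → ℤ → ℤ → ℤ
  a-step c x y = x + growth c y

  private
    0≤r+1 : 0ℤ ≤ + r + 1ℤ
    0≤r+1 = +≤+ z≤n

    0≤m : 0ℤ ≤ + m
    0≤m = +≤+ z≤n

  b-step-nonNeg : ∀ {c y} → 0ℤ ≤ c → 0ℤ ≤ y → 0ℤ ≤ b-step c y
  b-step-nonNeg 0≤c 0≤y = +-mono-≤ 0≤y (*-nonNeg 0≤c 0≤m)

  a-step-nonNeg : ∀ {c x y} → 0ℤ ≤ c → 0ℤ ≤ x → 0ℤ ≤ y → 0ℤ ≤ a-step c x y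
  a-step-nonNeg 0≤c 0≤x 0≤y = +-mono-≤ 0≤x (*-nonNeg (*-nonNeg 0≤r+1 (b-step-nonNeg 0≤c 0≤y)) 0≤c)

  b-step-mono : ∀ {c′ c y′ y} → 0ℤ ≤ c′ → c′ ≤ c → y′ ≤ y → b-step c′ y′ ≤ b-step c y
  b-step-mono 0≤c′ c′≤c y′≤y = +-mono-≤ y′≤y (*-mono-≤-nonNeg 0≤c′ c′≤c 0≤m ≤-refl)

  growth-mono : ∀ {c′ c y′ y} → 0ℤ ≤ c′ → c′ ≤ c → 0ℤ ≤ y′ → y′ ≤ y → growth c′ y′ ≤ growth c y
  growth-mono 0≤c′ c′≤c 0≤y′ y′≤y =
    *-mono-≤-nonNeg (*-nonNeg 0≤r+1 (b-step-nonNeg 0≤c′ 0≤y′))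
      (*-mono-≤-nonNeg 0≤r+1 ≤-refl (b-step-nonNeg 0≤c′ 0≤y′) (b-step-mono 0≤c′ c′≤c y′≤y))
      0≤c′ c′≤c

  -- Raising c by one adds (r+1)(y + c·m + (1+c)·m) ≥ 1 to the growth term;
  -- this is where m ≥ 1 is used.
  growth-strict : 1 ℕ.≤ m → ∀ {c′ c y′ y} → 0ℤ ≤ c′ → c′ < c → 0ℤ ≤ y′ → y′ ≤ y → growth c′ y′ < growth c y
  growth-strict 1≤m {c′} {c} {y′} {y} 0≤c′ c′<c 0≤y′ y′≤y = begin-strict
    growth c′ y′                    <⟨ i<i+j 1≤increment ⟩
    growth c′ y′ + increment        ≡⟨ sym (growth-suc-identity (+ r) (+ m) c′ y′) ⟩
    growth (1ℤ + c′) y′             ≤⟨ growth-mono (≤-trans 0≤c′ (i≤suc[i] c′)) (i<j⇒suc[i]≤j c′<c) 0≤y′ y′≤y ⟩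
    growth c y                      ∎
    where
      open ≤-Reasoning
      increment : ℤ
      increment = (+ r + 1ℤ) * (b-step c′ y′ + (1ℤ + c′) * + m)
      1≤increment : 1ℤ ≤ increment
      1≤increment =
        *-mono-≤-nonNeg (+≤+ z≤n) (+≤+ (ℕ.m≤n+m 1 r)) (+≤+ z≤n)
          (+-mono-≤ (b-step-nonNeg 0≤c′ 0≤y′)
            (*-mono-≤-nonNeg (+≤+ z≤n) (+-monoʳ-≤ 1ℤ 0≤c′) (+≤+ z≤n) (+≤+ 1≤m)))

  a-step-mono : ∀ {c′ c x′ x y′ y} → 0ℤ ≤ c′ → c′ ≤ c → x′ ≤ x → 0ℤ ≤ y′ → y′ ≤ y →
                a-step c′ x′ y′ ≤ a-step c x y
  a-step-mono 0≤c′ c′≤c x′≤x 0≤y′ y′≤y = +-mono-≤ x′≤x (growth-mono 0≤c′ c′≤c 0≤y′ y′≤y)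

  a-step-strictˣ : ∀ {c′ c x′ x y′ y} → 0ℤ ≤ c′ → c′ ≤ c → x′ < x → 0ℤ ≤ y′ → y′ ≤ y →
                   a-step c′ x′ y′ < a-step c x y
  a-step-strictˣ 0≤c′ c′≤c x′<x 0≤y′ y′≤y = +-mono-<-≤ x′<x (growth-mono 0≤c′ c′≤c 0≤y′ y′≤y)

  a-step-strictᶜ : 1 ℕ.≤ m → ∀ {c′ c x′ x y′ y} → 0ℤ ≤ c′ → c′ < c → x′ ≤ x → 0ℤ ≤ y′ → y′ ≤ y →
                   a-step c′ x′ y′ < a-step c x y
  a-step-strictᶜ 1≤m 0≤c′ c′<c x′≤x 0≤y′ y′≤y = +-mono-≤-< x′≤x (growth-strict 1≤m 0≤c′ c′<c 0≤y′ y′≤y)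

  a-steps-nonNeg : ∀ {n c} {xs ys : Vec ℤ n} → 0ℤ ≤ c → Nat-vec xs → Nat-vec ys →
                   Nat-vec (zipWith (a-step c) xs ys)
  a-steps-nonNeg 0≤c [] [] = []
  a-steps-nonNeg 0≤c (0≤x ∷ 0≤xs) (0≤y ∷ 0≤ys) = a-step-nonNeg 0≤c 0≤x 0≤y ∷ a-steps-nonNeg 0≤c 0≤xs 0≤ys

  b-steps-nonNeg : ∀ {n c} {ys : Vec ℤ n} → 0ℤ ≤ c → Nat-vec ys → Nat-vec (map (b-step c) ys)
  b-steps-nonNeg 0≤c [] = []
  b-steps-nonNeg 0≤c (0≤y ∷ 0≤ys) = b-step-nonNeg 0≤c 0≤y ∷ b-steps-nonNeg 0≤c 0≤ys

  measure-nonNeg : ∀ {n} {a b : Vec ℤ (suc n)} → Nat-vec a → Nat-vec b → 0ℤ ≤ measure' m r n a b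
  measure-nonNeg {zero} (0≤x ∷ []) (_ ∷ []) = 0≤x
  measure-nonNeg {suc n} (0≤c ∷ 0≤as) (_ ∷ 0≤bs) =
    measure-nonNeg (a-steps-nonNeg 0≤c 0≤as 0≤bs) (b-steps-nonNeg 0≤c 0≤bs)

  b-steps-mono : ∀ {n c′ c} {ys′ ys : Vec ℤ n} → 0ℤ ≤ c′ → c′ ≤ c →
                 Pointwise _≤_ ys′ ys → Pointwise _≤_ (map (b-step c′) ys′) (map (b-step c) ys)
  b-steps-mono 0≤c′ c′≤c ys′≤ys = Pointwise.map⁺ (b-step-mono 0≤c′ c′≤c) ys′≤ys

  a-steps-mono : ∀ {n c′ c} {xs′ xs ys′ ys : Vec ℤ n} → 0ℤ ≤ c′ → c′ ≤ c → Nat-vec ys′ →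
                 Pointwise _≤_ xs′ xs → Pointwise _≤_ ys′ ys →
                 Pointwise _≤_ (zipWith (a-step c′) xs′ ys′) (zipWith (a-step c) xs ys)
  a-steps-mono 0≤c′ c′≤c [] [] [] = []
  a-steps-mono 0≤c′ c′≤c (0≤y′ ∷ 0≤ys′) (x′≤x ∷ xs′≤xs) (y′≤y ∷ ys′≤ys) =
    a-step-mono 0≤c′ c′≤c x′≤x 0≤y′ y′≤y ∷ a-steps-mono 0≤c′ c′≤c 0≤ys′ xs′≤xs ys′≤ys

  a-steps-≺ : ∀ {n c′ c} {xs′ xs ys′ ys : Vec ℤ n} → 0ℤ ≤ c′ → c′ ≤ c → Nat-vec ys′ →
              xs′ ≺ xs → Pointwise _≤_ ys′ ys → zipWith (a-step c′) xs′ ys′ ≺ zipWith (a-step c) xs ys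
  a-steps-≺ 0≤c′ c′≤c (0≤y′ ∷ 0≤ys′) (here x′<x xs′≤xs) (y′≤y ∷ ys′≤ys) =
    here (a-step-strictˣ 0≤c′ c′≤c x′<x 0≤y′ y′≤y) (a-steps-mono 0≤c′ c′≤c 0≤ys′ xs′≤xs ys′≤ys)
  a-steps-≺ 0≤c′ c′≤c (0≤y′ ∷ 0≤ys′) (there x′≤x xs′≺xs) (y′≤y ∷ ys′≤ys) =
    there (a-step-mono 0≤c′ c′≤c x′≤x 0≤y′ y′≤y) (a-steps-≺ 0≤c′ c′≤c 0≤ys′ xs′≺xs ys′≤ys)

  -- One recursion step of measure' turns (c′ ∷ xs′) ≺ (c ∷ xs) into ≺ of the
  -- stepped tails: a strict drop in the leading entry becomes a strict drop
  -- of the first later entry, a strict drop further on is carried along.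
  ≺-step : 1 ℕ.≤ m → ∀ {n c′ c} {xs′ xs ys′ ys : Vec ℤ (suc n)} → 0ℤ ≤ c′ → Nat-vec ys′ →
           (c′ ∷ xs′) ≺ (c ∷ xs) → Pointwise _≤_ ys′ ys →
           zipWith (a-step c′) xs′ ys′ ≺ zipWith (a-step c) xs ys
  ≺-step 1≤m 0≤c′ (0≤y′ ∷ 0≤ys′) (here c′<c (x′≤x ∷ xs′≤xs)) (y′≤y ∷ ys′≤ys) =
    here (a-step-strictᶜ 1≤m 0≤c′ c′<c x′≤x 0≤y′ y′≤y) (a-steps-mono 0≤c′ (<⇒≤ c′<c) 0≤ys′ xs′≤xs ys′≤ys)
  ≺-step 1≤m 0≤c′ 0≤ys′ (there c′≤c xs′≺xs) ys′≤ys = a-steps-≺ 0≤c′ c′≤c 0≤ys′ xs′≺xs ys′≤ys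

  measure-strict : 1 ℕ.≤ m → ∀ {n} {a′ a b′ b : Vec ℤ (suc n)} → Nat-vec a′ → Nat-vec b′ →
                   a′ ≺ a → Pointwise _≤_ b′ b → measure' m r n a′ b′ < measure' m r n a b
  measure-strict 1≤m {zero} _ (_ ∷ []) (here x′<x []) (_ ∷ []) = x′<x
  measure-strict 1≤m {zero} _ _ (there _ ()) _
  measure-strict 1≤m {suc n} {a = _ ∷ _} (0≤c′ ∷ 0≤as′) (_ ∷ 0≤bs′) a′≺a (_ ∷ bs′≤bs) =
    measure-strict 1≤m (a-steps-nonNeg 0≤c′ 0≤as′ 0≤bs′) (b-steps-nonNeg 0≤c′ 0≤bs′)
      (≺-step 1≤m 0≤c′ 0≤bs′ a′≺a bs′≤bs) (b-steps-mono 0≤c′ (≺-head a′≺a) bs′≤bs)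

  t′ : ∀ {n} → ℕ → Vec ℤ n → Vec ℤ n → Vec ℤ n
  t′ k a b = tabulate λ j →
    pick (toℕ j) k (lookup a j) (lookup a j - 1ℤ) (lookup a j + (+ r) * (lookup b j + (+ m)))

  v′ : ∀ {n} → ℕ → Vec ℤ n → Vec ℤ n
  v′ k b = tabulate λ j → pick (toℕ j) k (lookup b j) (lookup b j) (lookup b j + (+ m))

  -- It is the relation t_k/v_k create and that every
  -- recursion step with a common leading entry preserves.
  data Carried : ∀ {n} → (a b a′ b′ : Vec ℤ n) → Set where
    [] : Carried [] [] [] []
    carry : ∀ {n x y x′ y′} {as bs as′ bs′ : Vec ℤ n} →
            x′ ≤ x + (+ r + 1ℤ) * y + + r * + m → y′ ≡ y + + m →
            Carried as bs as′ bs′ → Carried (x ∷ as) (y ∷ bs) (x′ ∷ as′) (y′ ∷ bs′)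

  data Shifted : ∀ {n} → ℕ → (a b a′ b′ : Vec ℤ n) → Set where
    pivot : ∀ {n x x′ y} {as bs as′ bs′ : Vec ℤ (suc n)} → x ≡ x′ + 1ℤ →
            Carried as bs as′ bs′ → Shifted zero (x ∷ as) (y ∷ bs) (x′ ∷ as′) (y ∷ bs′)
    skip  : ∀ {n k x y} {as bs as′ bs′ : Vec ℤ n} →
            Shifted k as bs as′ bs′ → Shifted (suc k) (x ∷ as) (y ∷ bs) (x ∷ as′) (y ∷ bs′)

  carried-step : ∀ {n c} {a b a′ b′ : Vec ℤ n} → Carried a b a′ b′ →
                 Carried (zipWith (a-step c) a b) (map (b-step c) b) (zipWith (a-step c) a′ b′) (map (b-step c) b′)
  carried-step [] = []
  carried-step {c = c} (carry {x = x} {y} {x′} x′≤ refl rest) =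
    carry (subst (a-step c x′ (y + + m) ≤_) (carry-identity (+ r) (+ m) c x y) (+-monoˡ-≤ _ x′≤))
          (b-carry-identity (+ m) c y) (carried-step rest)

  shifted-step : ∀ {n k c} {a b a′ b′ : Vec ℤ n} → Shifted k a b a′ b′ →
                 Shifted k (zipWith (a-step c) a b) (map (b-step c) b) (zipWith (a-step c) a′ b′) (map (b-step c) b′)
  shifted-step {c = c} (pivot {x′ = x′} {y} refl rest) =
    pivot (a-unit-identity (growth c y) x′) (carried-step rest)
  shifted-step (skip rest) = skip (shifted-step rest)

  carried-drop : 1 ℕ.≤ m → ∀ {n c} {a b a′ b′ : Vec ℤ n} → 0ℤ ≤ c → Carried a b a′ b′ →
                 Pointwise _<_ (zipWith (a-step c) a′ b′) (zipWith (a-step (c + 1ℤ)) a b)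
  carried-drop 1≤m 0≤c [] = []
  carried-drop 1≤m {c = c} 0≤c (carry {x = x} {y} {x′} x′≤ refl rest) = entry-drop ∷ carried-drop 1≤m 0≤c rest
    where
      open ≤-Reasoning
      bound : ℤ
      bound = x + (+ r + 1ℤ) * y + + r * + m
      entry-drop : a-step c x′ (y + + m) < a-step (c + 1ℤ) x y
      entry-drop = begin-strict
        a-step c x′ (y + + m)                                    ≤⟨ +-monoˡ-≤ _ x′≤ ⟩
        a-step c bound (y + + m)                                 <⟨ i<i+j (+-mono-≤ (+≤+ 1≤m) (*-nonNeg (*-nonNeg 0≤r+1 0≤c) 0≤m)) ⟩
        a-step c bound (y + + m) + (+ m + (+ r + 1ℤ) * c * + m)  ≡⟨ drop-identity (+ r) (+ m) c x y ⟩
        a-step (c + 1ℤ) x y                                      ∎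

  carried-b-drop : ∀ {n c} {a b a′ b′ : Vec ℤ n} → Carried a b a′ b′ →
                   Pointwise _≤_ (map (b-step c) b′) (map (b-step (c + 1ℤ)) b)
  carried-b-drop [] = []
  carried-b-drop {c = c} (carry {y = y} _ refl rest) =
    ≤-reflexive (b-drop-identity (+ m) c y) ∷ carried-b-drop {c = c} rest

  shifted-decrease : 1 ℕ.≤ m → ∀ {n k} {a b a′ b′ : Vec ℤ (suc n)} →
                     Nat-vec a′ → Nat-vec b′ → Shifted k a b a′ b′ →
                     measure' m r n a′ b′ < measure' m r n a b
  shifted-decrease 1≤m (0≤x′ ∷ 0≤as′) (_ ∷ 0≤bs′) (pivot {x′ = x′} refl rest) =
    measure-strict 1≤m (a-steps-nonNeg 0≤x′ 0≤as′ 0≤bs′) (b-steps-nonNeg 0≤x′ 0≤bs′)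
      (pointwise-<⇒≺ (carried-drop 1≤m 0≤x′ rest)) (carried-b-drop {c = x′} rest)
  shifted-decrease 1≤m {suc n} (0≤x ∷ 0≤as′) (_ ∷ 0≤bs′) (skip {x = x} rest) =
    shifted-decrease 1≤m (a-steps-nonNeg 0≤x 0≤as′ 0≤bs′) (b-steps-nonNeg 0≤x 0≤bs′)
      (shifted-step {c = x} rest)

  t-carried : ∀ {n} (xs ys : Vec ℤ n) → Nat-vec ys →
              Carried xs ys (tabulate λ j → lookup xs j + (+ r) * (lookup ys j + (+ m)))
                            (tabulate λ j → lookup ys j + (+ m))
  t-carried [] [] [] = []
  t-carried (x ∷ xs) (y ∷ ys) (+≤+ _ ∷ 0≤ys) =
    carry (subst (x + (+ r) * (y + (+ m)) ≤_) (sym (t-tail-identity (+ r) (+ m) x y)) (i≤i+j _ y))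
          refl (t-carried xs ys 0≤ys)

  t-shifted : ∀ {n} (k : Fin (suc n)) (a b : Vec ℤ (suc (suc n))) → Nat-vec b →
              Shifted (toℕ k) a b (t′ (toℕ k) a b) (v′ (toℕ k) b)
  t-shifted fzero (x ∷ xs) (y ∷ ys) (_ ∷ 0≤ys) = pivot (unit-identity x) (t-carried xs ys 0≤ys)
  t-shifted {suc n} (fsuc k) (x ∷ xs) (y ∷ ys) (_ ∷ 0≤ys) = skip (t-shifted k xs ys 0≤ys)

lemma9 : (d m r : ℕ) → 1 Data.Nat.≤ m →
    (a b : Vec ℤ (suc (suc d))) → Nat-vec a → Nat-vec b →
    ((k : Fin (suc d)) →
       Nat-vec (t m r (toℕ k) a b) → Nat-vec (v m (toℕ k) b) →
       (0ℤ ≤ measure m r d (t m r (toℕ k) a b) (v m (toℕ k) b))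
       × (measure m r d (t m r (toℕ k) a b) (v m (toℕ k) b) < measure m r d a b))
    × ((k : Fin (suc (suc d))) →
       Nat-vec (u (toℕ k) a) →
       (0ℤ ≤ measure m r d (u (toℕ k) a) b)
       × (measure m r d (u (toℕ k) a) b < measure m r d a b))
lemma9 d m r 1≤m a b _ 0≤b = part-t , part-u
  where
    part-t : (k : Fin (suc d)) → Nat-vec (t m r (toℕ k) a b) → Nat-vec (v m (toℕ k) b) →
             (0ℤ ≤ measure m r d (t m r (toℕ k) a b) (v m (toℕ k) b))
             × (measure m r d (t m r (toℕ k) a b) (v m (toℕ k) b) < measure m r d a b)
    part-t k 0≤t 0≤v =
      measure-nonNeg m r 0≤t 0≤v , shifted-decrease m r 1≤m 0≤t 0≤v (t-shifted m r k a b 0≤b)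

    part-u : (k : Fin (suc (suc d))) → Nat-vec (u (toℕ k) a) →
             (0ℤ ≤ measure m r d (u (toℕ k) a) b) × (measure m r d (u (toℕ k) a) b < measure m r d a b)
    part-u k 0≤u = measure-nonNeg m r 0≤u 0≤b , measure-strict m r 1≤m 0≤u 0≤b (u-≺ k a) (Pointwise.refl ≤-refl)
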